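{- Let $L$ be a chordal graph isomorphic to the line graph of some graph, and let $X_1,X_2,X_3$ be pairwise distinct maximal cliques of $L$ such that $X_1\cap X_2\cap X_3\neq\emptyset$. Then there are $i,j,k$ with $\{i,j,k\}=\{1,2,3\}$ such that $X_i\subseteq X_j\cup X_k$ and $|X_i|=3$.
   Context: Graphs are finite, simple and undirected. The line graph $L(G)$ has vertex set $E(G)$, two edges adjacent iff they share an endvertex. A graph is chordal if it has no induced cycle of length at least $4$. Maximal cliques are cliques maximal with respect to set inclusion. -}

module Defs where

open import Data.Nat using (ℕ; zero; suc; _<_; _≤_)
open import Data.Fin using (Fin; toℕ)
open import Data.Fin.Subset using (Subset; _∈_; _⊆_)
open import Data.Bool using (Bool; true; false)
open import Data.Product using (Σ; _×_; _,_; ∃)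
open import Data.Sum using (_⊎_)
open import Relation.Binary.PropositionalEquality using (_≡_; _≢_)
open import Function.Definitions using (Injective; Surjective; Bijective)
open import Function.Bundles using (_⇔_)

record Graph : Set where
  field
    n     : ℕ
    adj   : Fin n → Fin n → Bool
    sym   : ∀ x y → adj x y ≡ adj y x
    irr   : ∀ x → adj x x ≡ false

open Graph public

Adj : (G : Graph) → Fin (n G) → Fin (n G) → Set
Adj G x y = adj G x y ≡ true

-- Edges of G: unordered pairs {u,v}, represented canonically with u < v.
Edge : Graph → Set
Edge G = Σ (Fin (n G) × Fin (n G)) λ { (u , v) → (toℕ u < toℕ v) × Adj G u v }

endpoints : (G : Graph) → Edge G → Fin (n G) × Fin (n G)
endpoints G (p , _) = p

_isEndOf_ : {G : Graph} → Fin (n G) → Edge G → Set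
_isEndOf_ x ((u , v) , _) = (x ≡ u) ⊎ (x ≡ v)

LineAdj : (G : Graph) → Edge G → Edge G → Set
LineAdj G e f = (e ≢ f) × ∃ λ (x : Fin (n G)) → (_isEndOf_ {G} x e) × (_isEndOf_ {G} x f)

IsoToLineGraphOf : Graph → Graph → Set
IsoToLineGraphOf L H =
  Σ (Fin (n L) → Edge H) λ f →
    Bijective _≡_ _≡_ f × (∀ x y → Adj L x y ⇔ LineAdj H (f x) (f y))

IsLineGraph : Graph → Set
IsLineGraph L = Σ Graph λ H → IsoToLineGraphOf L H

CycAdj : (k : ℕ) → Fin k → Fin k → Set
CycAdj k i j =
  (toℕ j ≡ suc (toℕ i)) ⊎ (toℕ i ≡ suc (toℕ j))
  ⊎ ((toℕ i ≡ 0) × (suc (toℕ j) ≡ k)) ⊎ ((toℕ j ≡ 0) × (suc (toℕ i) ≡ k))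

InducedCycle : (G : Graph) → ℕ → Set
InducedCycle G k =
  Σ (Fin k → Fin (n G)) λ c →
    Injective _≡_ _≡_ c × (∀ i j → Adj G (c i) (c j) ⇔ CycAdj k i j)

Chordal : Graph → Set
Chordal G = ∀ k → 4 ≤ k → InducedCycle G k → Data.Empty.⊥
  where import Data.Empty

IsClique : (G : Graph) → Subset (n G) → Set
IsClique G X = ∀ x y → x ∈ X → y ∈ X → x ≢ y → Adj G x y

IsMaximalClique : (G : Graph) → Subset (n G) → Set
IsMaximalClique G X = IsClique G X × (∀ Y → IsClique G Y → X ⊆ Y → Y ⊆ X)

module Submission where

-- Identify L with the line graph L(H) and let the common vertex x be the edge uv of H.
-- A clique of L(H) through uv consists of edges at u, or of edges at v, or is a
-- triangle {uv, vw, uw}. A maximal clique of one of the first two kinds is the whole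
-- star at u (resp. v), so at most one of X₁, X₂, X₃ is of each of these kinds; and two
-- different triangles {uv, vw, uw}, {uv, vw', uw'} would make uw, vw, vw', uw' an
-- induced 4-cycle. Hence the three cliques are the star at u, the star at v and a
-- triangle, which has three elements and lies in the union of the two stars.

open import Defs hiding (sym)
open import Data.Nat as ℕ using (suc; _+_; _<_)
open import Data.Nat.Properties using (<-irrelevant; <-asym; <⇒≢; <-cmp; ≤-refl)
open import Data.Fin as Fin using (Fin; toℕ; _≟_)
open import Data.Fin.Patterns using (0F; 1F; 2F; 3F)
open import Data.Fin.Properties using (toℕ-injective; ¬∀⟶∃¬)
open import Data.Fin.Subset using (Subset; _∈_; _∉_; _⊆_; _∩_; _∪_; ∣_∣; ⁅_⁆; inside; outside)
open import Data.Fin.Subset.Properties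
  using (_∈?_; _⊆?_; ⊆-antisym; x∈p∩q⁻; x∈p∪q⁻; x∈p∪q⁺; p⊆p∪q; q⊆p∪q; ∪-comm; ∪-identityʳ;
         x∈⁅x⁆; x∈⁅y⁆⇒x≡y; x≢y⇒x∉⁅y⁆; ∣⁅x⁆∣≡1)
open import Data.Vec using (_∷_; here; there; tabulate)
open import Data.Vec.Properties using (lookup∘tabulate; []=⇒lookup; lookup⇒[]=)
open import Data.Bool using (true)
import Data.Bool as Bool
open import Data.Product using (_×_; _,_; ∃; proj₁; proj₂)
open import Data.Sum using (_⊎_; inj₁; inj₂; [_,_]′)
open import Data.Empty using (⊥-elim)
open import Function using (_∘_; id)
open import Function.Definitions using (Injective)
open import Function.Bundles using (_⇔_; Equivalence; mk⇔)
open import Relation.Nullary using (¬_; Dec; yes; no; does)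
open import Relation.Nullary.Decidable
  using (True; False; toWitness; toWitnessFalse; dec-true; _⊎-dec_; _×-dec_; _→-dec_)
open import Relation.Unary using (Pred; Decidable)
open import Relation.Binary.Definitions using (tri<; tri≈; tri>)
open import Relation.Binary.PropositionalEquality
  using (_≡_; _≢_; refl; sym; trans; cong; cong₂; subst; ≢-sym; module ≡-Reasoning)
open import Axiom.UniquenessOfIdentityProofs using (module Decidable⇒UIP)

⊈⇒∃∉ : ∀ {n} {p q : Subset n} → ¬ p ⊆ q → ∃ λ x → x ∈ p × x ∉ q
⊈⇒∃∉ {n} {p} {q} p⊈q with ¬∀⟶∃¬ n (λ x → x ∈ p → x ∈ q) (λ x → x ∈? p →-dec x ∈? q) (λ p⊆q → p⊈q (p⊆q _))
... | x , ¬[x∈p→x∈q] with x ∈? p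
...   | yes x∈p = x , x∈p , ¬[x∈p→x∈q] ∘ (λ x∈q _ → x∈q)
...   | no x∉p = ⊥-elim (¬[x∈p→x∈q] (⊥-elim ∘ x∉p))

satisfying : ∀ {n ℓ} {P : Pred (Fin n) ℓ} → Decidable P → Subset n
satisfying P? = tabulate (λ x → does (P? x))

module _ {n ℓ} {P : Pred (Fin n) ℓ} (P? : Decidable P) where

  ∈-satisfying⁺ : ∀ {x} → P x → x ∈ satisfying P?
  ∈-satisfying⁺ {x} Px = lookup⇒[]= x _ (trans (lookup∘tabulate _ x) (dec-true (P? x) Px))

  ∈-satisfying⁻ : ∀ {x} → x ∈ satisfying P? → P x
  ∈-satisfying⁻ {x} x∈ = fromDoes (P? x) (trans (sym (lookup∘tabulate _ x)) ([]=⇒lookup x∈))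
    where
    fromDoes : ∀ {A : Set ℓ} (A? : Dec A) → does A? ≡ true → A
    fromDoes (yes a) _ = a

triple : ∀ {n} → Fin n → Fin n → Fin n → Subset n
triple x y z = (⁅ x ⁆ ∪ ⁅ y ⁆) ∪ ⁅ z ⁆

module _ {n} {x y z : Fin n} where

  triple⊆ : ∀ {p} → x ∈ p → y ∈ p → z ∈ p → triple x y z ⊆ p
  triple⊆ x∈p y∈p z∈p c∈xyz with x∈p∪q⁻ (⁅ x ⁆ ∪ ⁅ y ⁆) ⁅ z ⁆ c∈xyz
  ... | inj₂ c∈z rewrite x∈⁅y⁆⇒x≡y z c∈z = z∈p
  ... | inj₁ c∈xy with x∈p∪q⁻ ⁅ x ⁆ ⁅ y ⁆ c∈xy
  ...   | inj₁ c∈x rewrite x∈⁅y⁆⇒x≡y x c∈x = x∈p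
  ...   | inj₂ c∈y rewrite x∈⁅y⁆⇒x≡y y c∈y = y∈p

  ⊆triple : ∀ {p} → (∀ {c} → c ∈ p → c ≡ x ⊎ c ≡ y ⊎ c ≡ z) → p ⊆ triple x y z
  ⊆triple members c∈p with members c∈p
  ... | inj₁ refl = x∈p∪q⁺ (inj₁ (x∈p∪q⁺ (inj₁ (x∈⁅x⁆ x))))
  ... | inj₂ (inj₁ refl) = x∈p∪q⁺ (inj₁ (x∈p∪q⁺ (inj₂ (x∈⁅x⁆ y))))
  ... | inj₂ (inj₂ refl) = x∈p∪q⁺ (inj₂ (x∈⁅x⁆ z))

∣p∪⁅x⁆∣≡1+∣p∣ : ∀ {n} (p : Subset n) {x} → x ∉ p → ∣ p ∪ ⁅ x ⁆ ∣ ≡ suc ∣ p ∣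
∣p∪⁅x⁆∣≡1+∣p∣ (inside ∷ p) {0F} x∉p = ⊥-elim (x∉p here)
∣p∪⁅x⁆∣≡1+∣p∣ (outside ∷ p) {0F} _ = cong (suc ∘ ∣_∣) (∪-identityʳ p)
∣p∪⁅x⁆∣≡1+∣p∣ (inside ∷ p) {Fin.suc x} x∉p = cong suc (∣p∪⁅x⁆∣≡1+∣p∣ p (x∉p ∘ there))
∣p∪⁅x⁆∣≡1+∣p∣ (outside ∷ p) {Fin.suc x} x∉p = ∣p∪⁅x⁆∣≡1+∣p∣ p (x∉p ∘ there)

∣triple∣≡3 : ∀ {n} {x y z : Fin n} → x ≢ y → x ≢ z → y ≢ z → ∣ triple x y z ∣ ≡ 3
∣triple∣≡3 {x = x} {y} {z} x≢y x≢z y≢z = begin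
  ∣ (⁅ x ⁆ ∪ ⁅ y ⁆) ∪ ⁅ z ⁆ ∣  ≡⟨ ∣p∪⁅x⁆∣≡1+∣p∣ (⁅ x ⁆ ∪ ⁅ y ⁆) z∉xy ⟩
  suc ∣ ⁅ x ⁆ ∪ ⁅ y ⁆ ∣        ≡⟨ cong suc (∣p∪⁅x⁆∣≡1+∣p∣ ⁅ x ⁆ (x≢y⇒x∉⁅y⁆ (≢-sym x≢y))) ⟩
  2 + ∣ ⁅ x ⁆ ∣                ≡⟨ cong (2 +_) (∣⁅x⁆∣≡1 x) ⟩
  3                            ∎
  where
  open ≡-Reasoning
  z∉xy : z ∉ ⁅ x ⁆ ∪ ⁅ y ⁆
  z∉xy z∈xy = [ x≢z ∘ sym ∘ x∈⁅y⁆⇒x≡y x , y≢z ∘ sym ∘ x∈⁅y⁆⇒x≡y y ]′ (x∈p∪q⁻ ⁅ x ⁆ ⁅ y ⁆ z∈xy)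

CycAdj? : ∀ k (i j : Fin k) → Dec (CycAdj k i j)
CycAdj? k i j =
  (toℕ j ℕ.≟ suc (toℕ i)) ⊎-dec (toℕ i ℕ.≟ suc (toℕ j))
  ⊎-dec ((toℕ i ℕ.≟ 0) ×-dec (suc (toℕ j) ℕ.≟ k)) ⊎-dec ((toℕ j ℕ.≟ 0) ×-dec (suc (toℕ i) ℕ.≟ k))

module _ (G : Graph) where

  ¬Adj-refl : ∀ {x} → ¬ Adj G x x
  ¬Adj-refl {x} x~x with trans (sym x~x) (irr G x)
  ... | ()

  adj⇒≢ : ∀ {x y} → Adj G x y → x ≢ y
  adj⇒≢ x~y refl = ¬Adj-refl x~y

  Adj-sym : ∀ {x y} → Adj G x y → Adj G y x
  Adj-sym {x} {y} x~y = trans (Graph.sym G y x) x~y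

  maximal⊆clique⇒≡ : ∀ {X Y} → IsMaximalClique G X → IsClique G Y → X ⊆ Y → X ≡ Y
  maximal⊆clique⇒≡ (_ , maximal) Y-clique X⊆Y = ⊆-antisym X⊆Y (maximal _ Y-clique X⊆Y)

  square⇒inducedCycle : ∀ {a b c d} → Adj G a b → Adj G b c → Adj G c d → Adj G d a →
    ¬ Adj G a c → ¬ Adj G b d → a ≢ c → b ≢ d → InducedCycle G 4
  square⇒inducedCycle {a} {b} {c} {d} a~b b~c c~d d~a a≁c b≁d a≢c b≢d = cycle , injective , adjacency
    where
    cycle : Fin 4 → Fin (n G)
    cycle 0F = a
    cycle 1F = b
    cycle 2F = c
    cycle 3F = d

    injective : Injective _≡_ _≡_ cycle
    injective {0F} {0F} _ = refl
    injective {1F} {1F} _ = refl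
    injective {2F} {2F} _ = refl
    injective {3F} {3F} _ = refl
    injective {0F} {2F} = ⊥-elim ∘ a≢c
    injective {2F} {0F} = ⊥-elim ∘ a≢c ∘ sym
    injective {1F} {3F} = ⊥-elim ∘ b≢d
    injective {3F} {1F} = ⊥-elim ∘ b≢d ∘ sym
    injective {0F} {1F} = ⊥-elim ∘ adj⇒≢ a~b
    injective {1F} {0F} = ⊥-elim ∘ adj⇒≢ a~b ∘ sym
    injective {1F} {2F} = ⊥-elim ∘ adj⇒≢ b~c
    injective {2F} {1F} = ⊥-elim ∘ adj⇒≢ b~c ∘ sym
    injective {2F} {3F} = ⊥-elim ∘ adj⇒≢ c~d
    injective {3F} {2F} = ⊥-elim ∘ adj⇒≢ c~d ∘ sym
    injective {3F} {0F} = ⊥-elim ∘ adj⇒≢ d~a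
    injective {0F} {3F} = ⊥-elim ∘ adj⇒≢ d~a ∘ sym

    edge : ∀ {i j} → Adj G (cycle i) (cycle j) → {True (CycAdj? 4 i j)} →
           Adj G (cycle i) (cycle j) ⇔ CycAdj 4 i j
    edge i~j {cyc} = mk⇔ (λ _ → toWitness cyc) (λ _ → i~j)

    nonEdge : ∀ {i j} → ¬ Adj G (cycle i) (cycle j) → {False (CycAdj? 4 i j)} →
              Adj G (cycle i) (cycle j) ⇔ CycAdj 4 i j
    nonEdge i≁j {¬cyc} = mk⇔ (⊥-elim ∘ i≁j) (⊥-elim ∘ toWitnessFalse ¬cyc)

    adjacency : ∀ i j → Adj G (cycle i) (cycle j) ⇔ CycAdj 4 i j
    adjacency 0F 0F = nonEdge ¬Adj-refl
    adjacency 0F 1F = edge a~b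
    adjacency 0F 2F = nonEdge a≁c
    adjacency 0F 3F = edge (Adj-sym d~a)
    adjacency 1F 0F = edge (Adj-sym a~b)
    adjacency 1F 1F = nonEdge ¬Adj-refl
    adjacency 1F 2F = edge b~c
    adjacency 1F 3F = nonEdge b≁d
    adjacency 2F 0F = nonEdge (a≁c ∘ Adj-sym)
    adjacency 2F 1F = edge (Adj-sym b~c)
    adjacency 2F 2F = nonEdge ¬Adj-refl
    adjacency 2F 3F = edge c~d
    adjacency 3F 0F = edge d~a
    adjacency 3F 1F = nonEdge (b≁d ∘ Adj-sym)
    adjacency 3F 2F = edge (Adj-sym c~d)
    adjacency 3F 3F = nonEdge ¬Adj-refl

module Edges (G : Graph) where

  private
    V : Set
    V = Fin (n G)

  _isEndOfᴳ_ : V → Edge G → Set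
  z isEndOfᴳ e = _isEndOf_ {G} z e

  record Joins (e : Edge G) (a b : V) : Set where
    constructor joins
    field
      distinct : a ≢ b
      left     : a isEndOfᴳ e
      right    : b isEndOfᴳ e

  open Joins public

  Joins-sym : ∀ {e a b} → Joins e a b → Joins e b a
  Joins-sym (joins a≢b a∈e b∈e) = joins (≢-sym a≢b) b∈e a∈e

  joins-endpoints : (e : Edge G) → Joins e (proj₁ (endpoints G e)) (proj₂ (endpoints G e))
  joins-endpoints (_ , u<v , _) = joins (<⇒≢ u<v ∘ cong toℕ) (inj₁ refl) (inj₂ refl)

  joins-otherEnd : ∀ e {z} → z isEndOfᴳ e → ∃ λ w → Joins e z w
  joins-otherEnd e (inj₁ refl) = _ , joins-endpoints e
  joins-otherEnd e (inj₂ refl) = _ , Joins-sym (joins-endpoints e)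

  joins-ends : ∀ {e a b y} → Joins e a b → y isEndOfᴳ e → y ≡ a ⊎ y ≡ b
  joins-ends (joins _   (inj₁ refl) _)           (inj₁ refl) = inj₁ refl
  joins-ends (joins _   (inj₂ refl) _)           (inj₂ refl) = inj₁ refl
  joins-ends (joins _   (inj₂ refl) (inj₁ refl)) (inj₁ refl) = inj₂ refl
  joins-ends (joins _   (inj₁ refl) (inj₂ refl)) (inj₂ refl) = inj₂ refl
  joins-ends (joins a≢b (inj₁ refl) (inj₁ refl)) _           = ⊥-elim (a≢b refl)
  joins-ends (joins a≢b (inj₂ refl) (inj₂ refl)) _           = ⊥-elim (a≢b refl)

  joins-∉ : ∀ {e a b y} → Joins e a b → y ≢ a → y ≢ b → ¬ y isEndOfᴳ e
  joins-∉ e-joins y≢a y≢b = [ y≢a , y≢b ]′ ∘ joins-ends e-joins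

  Edge-≡ : (e e′ : Edge G) → endpoints G e ≡ endpoints G e′ → e ≡ e′
  Edge-≡ (_ , u<v , u~v) (_ , u<v′ , u~v′) refl
    rewrite <-irrelevant u<v u<v′ | Decidable⇒UIP.≡-irrelevant Bool._≟_ u~v u~v′ = refl

  endpoints-≡ : ∀ e {a b} → Joins e a b → toℕ a < toℕ b → endpoints G e ≡ (a , b)
  endpoints-≡ ((u , v) , u<v , _) (joins _ (inj₁ refl) (inj₂ refl)) _ = refl
  endpoints-≡ ((u , v) , u<v , _) (joins _ (inj₂ refl) (inj₁ refl)) v<u = ⊥-elim (<-asym u<v v<u)
  endpoints-≡ ((u , v) , u<v , _) (joins a≢b (inj₁ refl) (inj₁ refl)) _ = ⊥-elim (a≢b refl)
  endpoints-≡ ((u , v) , u<v , _) (joins a≢b (inj₂ refl) (inj₂ refl)) _ = ⊥-elim (a≢b refl)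

  joins-injective : ∀ {e e′ a b} → Joins e a b → Joins e′ a b → e ≡ e′
  joins-injective {e} {e′} {a} {b} e-joins e′-joins with <-cmp (toℕ a) (toℕ b)
  ... | tri< a<b _ _ =
    Edge-≡ e e′ (trans (endpoints-≡ e e-joins a<b) (sym (endpoints-≡ e′ e′-joins a<b)))
  ... | tri≈ _ a≡b _ = ⊥-elim (distinct e-joins (toℕ-injective a≡b))
  ... | tri> _ _ b<a = Edge-≡ e e′
    (trans (endpoints-≡ e (Joins-sym e-joins) b<a) (sym (endpoints-≡ e′ (Joins-sym e′-joins) b<a)))

module LineGraph (L H : Graph) (f : Fin (n L) → Edge H) (f-injective : Injective _≡_ _≡_ f)
                 (iso : ∀ c d → Adj L c d ⇔ LineAdj H (f c) (f d)) where

  open Edges H public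

  private
    V W : Set
    V = Fin (n L)
    W = Fin (n H)

  _∈ᵉ_ : W → V → Set
  z ∈ᵉ c = z isEndOfᴳ f c

  _∈ᵉ?_ : ∀ z c → Dec (z ∈ᵉ c)
  z ∈ᵉ? c = (z ≟ proj₁ (endpoints H (f c))) ⊎-dec (z ≟ proj₂ (endpoints H (f c)))

  ∉ᵉ-≢ : ∀ {z c d} → ¬ z ∈ᵉ c → z ∈ᵉ d → c ≢ d
  ∉ᵉ-≢ z∉c z∈d refl = z∉c z∈d

  joins⇒≡ : ∀ {c d a b} → Joins (f c) a b → Joins (f d) a b → c ≡ d
  joins⇒≡ c-joins d-joins = f-injective (joins-injective c-joins d-joins)

  commonEnd⇒adj : ∀ {c d z} → c ≢ d → z ∈ᵉ c → z ∈ᵉ d → Adj L c d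
  commonEnd⇒adj {c} {d} {z} c≢d z∈c z∈d =
    Equivalence.from (iso c d) (c≢d ∘ f-injective , z , z∈c , z∈d)

  adj⇒meets : ∀ {c d a b} → Adj L c d → Joins (f d) a b → a ∈ᵉ c ⊎ b ∈ᵉ c
  adj⇒meets {c} {d} c~d d-joins with proj₂ (Equivalence.to (iso c d) c~d)
  ... | z , z∈c , z∈d = [ (λ z≡a → inj₁ (subst (_∈ᵉ c) z≡a z∈c))
                        , (λ z≡b → inj₂ (subst (_∈ᵉ c) z≡b z∈c)) ]′ (joins-ends d-joins z∈d)

  disjoint⇒¬adj : ∀ {c d a b} → Joins (f c) a b → ¬ a ∈ᵉ d → ¬ b ∈ᵉ d → ¬ Adj L d c
  disjoint⇒¬adj c-joins a∉d b∉d d~c = [ a∉d , b∉d ]′ (adj⇒meets d~c c-joins)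

  edgesAt : W → Subset (n L)
  edgesAt z = satisfying (z ∈ᵉ?_)

  edgesAt-clique : ∀ z → IsClique L (edgesAt z)
  edgesAt-clique z c d c∈ d∈ c≢d =
    commonEnd⇒adj c≢d (∈-satisfying⁻ (z ∈ᵉ?_) c∈) (∈-satisfying⁻ (z ∈ᵉ?_) d∈)

  maximal⊆edgesAt⇒≡ : ∀ {X} z → IsMaximalClique L X → X ⊆ edgesAt z → X ≡ edgesAt z
  maximal⊆edgesAt⇒≡ z X-maximal = maximal⊆clique⇒≡ L X-maximal (edgesAt-clique z)

  edgeSquare⇒inducedCycle : ∀ {c₁ c₂ c₃ c₄ a b c d} →
    Joins (f c₁) a b → Joins (f c₂) b c → Joins (f c₃) c d → Joins (f c₄) d a →
    a ≢ c → b ≢ d → InducedCycle L 4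
  edgeSquare⇒inducedCycle {c₁} {c₂} {c₃} {c₄} {a} {b} {c} {d} j₁ j₂ j₃ j₄ a≢c b≢d =
    square⇒inducedCycle L
      (consecutive j₁ j₂ (≢-sym a≢c)) (consecutive j₂ j₃ (≢-sym b≢d))
      (consecutive j₃ j₄ a≢c) (consecutive j₄ j₁ b≢d)
      (disjoint⇒¬adj j₃ c∉c₁ d∉c₁) (disjoint⇒¬adj j₄ d∉c₂ a∉c₂)
      (∉ᵉ-≢ c∉c₁ (left j₃)) (∉ᵉ-≢ d∉c₂ (left j₄))
    where
    consecutive : ∀ {e₁ e₂ p q r} → Joins (f e₁) p q → Joins (f e₂) q r → r ≢ p → Adj L e₁ e₂
    consecutive pq qr r≢p =
      commonEnd⇒adj (∉ᵉ-≢ (joins-∉ pq r≢p (≢-sym (distinct qr))) (right qr)) (right pq) (left qr)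
    c∉c₁ : ¬ c ∈ᵉ c₁
    c∉c₁ = joins-∉ j₁ (≢-sym a≢c) (≢-sym (distinct j₂))
    d∉c₁ : ¬ d ∈ᵉ c₁
    d∉c₁ = joins-∉ j₁ (distinct j₄) (≢-sym b≢d)
    d∉c₂ : ¬ d ∈ᵉ c₂
    d∉c₂ = joins-∉ j₂ (≢-sym b≢d) (≢-sym (distinct j₃))
    a∉c₂ : ¬ a ∈ᵉ c₂
    a∉c₂ = joins-∉ j₂ (distinct j₁) a≢c

  module AtEdge (x : V) where

    u v : W
    u = proj₁ (endpoints H (f x))
    v = proj₂ (endpoints H (f x))

    x-joins : Joins (f x) u v
    x-joins = joins-endpoints (f x)

    record Triangle (X : Subset (n L)) : Set where
      field
        w        : W
        vw uw    : V
        vw-joins : Joins (f vw) v w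
        uw-joins : Joins (f uw) u w
        X≡       : X ≡ triple x vw uw

    module _ {X} (T : Triangle X) where
      open Triangle T

      triangle-card : ∣ X ∣ ≡ 3
      triangle-card = trans (cong ∣_∣ X≡) (∣triple∣≡3 x≢vw x≢uw vw≢uw)
        where
        u∉vw : ¬ u ∈ᵉ vw
        u∉vw = joins-∉ vw-joins (distinct x-joins) (distinct uw-joins)
        x≢vw : x ≢ vw
        x≢vw = ≢-sym (∉ᵉ-≢ u∉vw (left x-joins))
        x≢uw : x ≢ uw
        x≢uw = ≢-sym (∉ᵉ-≢ (joins-∉ uw-joins (≢-sym (distinct x-joins)) (distinct vw-joins)) (right x-joins))
        vw≢uw : vw ≢ uw
        vw≢uw = ∉ᵉ-≢ u∉vw (left uw-joins)

      triangle⊆stars : X ⊆ edgesAt u ∪ edgesAt v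
      triangle⊆stars = subst (_⊆ edgesAt u ∪ edgesAt v) (sym X≡) (triple⊆
        (p⊆p∪q (edgesAt v) (∈-satisfying⁺ (u ∈ᵉ?_) (left x-joins)))
        (q⊆p∪q (edgesAt u) (edgesAt v) (∈-satisfying⁺ (v ∈ᵉ?_) (left vw-joins)))
        (p⊆p∪q (edgesAt v) (∈-satisfying⁺ (u ∈ᵉ?_) (left uw-joins))))

    triangle-unique : Chordal L → ∀ {X Y} → Triangle X → Triangle Y → X ≡ Y
    triangle-unique chordal S T with Triangle.w S ≟ Triangle.w T
    ... | yes refl = begin
      _                   ≡⟨ S.X≡ ⟩
      triple x S.vw S.uw  ≡⟨ cong₂ (triple x) (joins⇒≡ S.vw-joins T.vw-joins)
                                              (joins⇒≡ S.uw-joins T.uw-joins) ⟩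
      triple x T.vw T.uw  ≡⟨ sym T.X≡ ⟩
      _                   ∎
      where
      open ≡-Reasoning
      module S = Triangle S
      module T = Triangle T
    ... | no w≢w′ = ⊥-elim (chordal 4 ≤-refl (edgeSquare⇒inducedCycle
      (Triangle.uw-joins S) (Joins-sym (Triangle.vw-joins S))
      (Triangle.vw-joins T) (Joins-sym (Triangle.uw-joins T)) (distinct x-joins) w≢w′))

    cliqueTriangle : ∀ {X} → IsClique L X → x ∈ X →
      ∀ {a} → a ∈ X → ¬ u ∈ᵉ a → ∀ {b} → b ∈ X → ¬ v ∈ᵉ b → Triangle X
    cliqueTriangle {X} X-clique x∈X {a} a∈X u∉a {b} b∈X v∉b = record
      { w = w ; vw = a ; uw = b ; vw-joins = a-joins ; uw-joins = b-joins
      ; X≡ = ⊆-antisym (⊆triple members) (triple⊆ x∈X a∈X b∈X) }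
      where
      meets : ∀ {c d p q} → c ∈ X → d ∈ X → c ≢ d → Joins (f d) p q → p ∈ᵉ c ⊎ q ∈ᵉ c
      meets c∈X d∈X c≢d = adj⇒meets (X-clique _ _ c∈X d∈X c≢d)
      v∈a : v ∈ᵉ a
      v∈a = [ ⊥-elim ∘ u∉a , id ]′ (meets a∈X x∈X (∉ᵉ-≢ u∉a (left x-joins)) x-joins)
      w : W
      w = proj₁ (joins-otherEnd (f a) v∈a)
      a-joins : Joins (f a) v w
      a-joins = proj₂ (joins-otherEnd (f a) v∈a)
      u∈b : u ∈ᵉ b
      u∈b = [ id , ⊥-elim ∘ v∉b ]′ (meets b∈X x∈X (∉ᵉ-≢ v∉b (right x-joins)) x-joins)
      w∈b : w ∈ᵉ b
      w∈b = [ ⊥-elim ∘ v∉b , id ]′ (meets b∈X a∈X (∉ᵉ-≢ v∉b (left a-joins)) a-joins)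
      b-joins : Joins (f b) u w
      b-joins = joins (λ u≡w → u∉a (subst (_∈ᵉ a) (sym u≡w) (right a-joins))) u∈b w∈b
      members : ∀ {c} → c ∈ X → c ≡ x ⊎ c ≡ a ⊎ c ≡ b
      members {c} c∈X with c ≟ x
      ... | yes c≡x = inj₁ c≡x
      ... | no c≢x with meets c∈X x∈X c≢x x-joins
      ...   | inj₁ u∈c =
        [ (λ v∈c → inj₁ (joins⇒≡ (joins (distinct x-joins) u∈c v∈c) x-joins))
        , (λ w∈c → inj₂ (inj₂ (joins⇒≡ (joins (distinct b-joins) u∈c w∈c) b-joins))) ]′
        (meets c∈X a∈X (≢-sym (∉ᵉ-≢ u∉a u∈c)) a-joins)
      ...   | inj₂ v∈c =
        [ (λ u∈c → inj₁ (joins⇒≡ (joins (distinct x-joins) u∈c v∈c) x-joins))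
        , (λ w∈c → inj₂ (inj₁ (joins⇒≡ (joins (distinct a-joins) v∈c w∈c) a-joins))) ]′
        (meets c∈X b∈X (≢-sym (∉ᵉ-≢ v∉b v∈c)) b-joins)

    data Shape (X : Subset (n L)) : Set where
      star-u   : X ⊆ edgesAt u → Shape X
      star-v   : X ⊆ edgesAt v → Shape X
      triangle : Triangle X → Shape X

    shape : ∀ {X} → IsClique L X → x ∈ X → Shape X
    shape {X} X-clique x∈X with X ⊆? edgesAt u | X ⊆? edgesAt v
    ... | yes X⊆u | _       = star-u X⊆u
    ... | no _    | yes X⊆v = star-v X⊆v
    ... | no X⊈u  | no X⊈v  with ⊈⇒∃∉ X⊈u | ⊈⇒∃∉ X⊈v
    ...   | a , a∈X , a∉u | b , b∈X , b∉v = triangle (cliqueTriangle X-clique x∈X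
      a∈X (a∉u ∘ ∈-satisfying⁺ (u ∈ᵉ?_)) b∈X (b∉v ∘ ∈-satisfying⁺ (v ∈ᵉ?_)))

    module _ (chordal : Chordal L) {X₁ X₂ X₃ : Subset (n L)} (m₁ : IsMaximalClique L X₁)
             (m₂ : IsMaximalClique L X₂) (m₃ : IsMaximalClique L X₃) where

      private
        stars-≡ : ∀ z {X Y} → IsMaximalClique L X → IsMaximalClique L Y →
                  X ⊆ edgesAt z → Y ⊆ edgesAt z → X ≡ Y
        stars-≡ z mX mY X⊆z Y⊆z = trans (maximal⊆edgesAt⇒≡ z mX X⊆z) (sym (maximal⊆edgesAt⇒≡ z mY Y⊆z))

        covered : ∀ {X Y Z} → Triangle X → edgesAt u ∪ edgesAt v ≡ Y ∪ Z → (X ⊆ Y ∪ Z) × (∣ X ∣ ≡ 3)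
        covered T stars≡ = subst (_ ⊆_) stars≡ (triangle⊆stars T) , triangle-card T

        stars-∪ : ∀ {Y Z} → IsMaximalClique L Y → IsMaximalClique L Z →
                  Y ⊆ edgesAt u → Z ⊆ edgesAt v → edgesAt u ∪ edgesAt v ≡ Y ∪ Z
        stars-∪ mY mZ Y⊆u Z⊆v = sym (cong₂ _∪_ (maximal⊆edgesAt⇒≡ u mY Y⊆u) (maximal⊆edgesAt⇒≡ v mZ Z⊆v))

      threeShapes : X₁ ≢ X₂ → X₁ ≢ X₃ → X₂ ≢ X₃ → Shape X₁ → Shape X₂ → Shape X₃ →
        ((X₁ ⊆ X₂ ∪ X₃) × (∣ X₁ ∣ ≡ 3))
        ⊎ ((X₂ ⊆ X₁ ∪ X₃) × (∣ X₂ ∣ ≡ 3))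
        ⊎ ((X₃ ⊆ X₁ ∪ X₂) × (∣ X₃ ∣ ≡ 3))
      threeShapes ≢₁₂ _ _ (star-u s) (star-u t) _ = ⊥-elim (≢₁₂ (stars-≡ u m₁ m₂ s t))
      threeShapes ≢₁₂ _ _ (star-v s) (star-v t) _ = ⊥-elim (≢₁₂ (stars-≡ v m₁ m₂ s t))
      threeShapes ≢₁₂ _ _ (triangle S) (triangle T) _ = ⊥-elim (≢₁₂ (triangle-unique chordal S T))
      threeShapes _ ≢₁₃ _ (star-u s) _ (star-u t) = ⊥-elim (≢₁₃ (stars-≡ u m₁ m₃ s t))
      threeShapes _ ≢₁₃ _ (star-v s) _ (star-v t) = ⊥-elim (≢₁₃ (stars-≡ v m₁ m₃ s t))
      threeShapes _ ≢₁₃ _ (triangle S) _ (triangle T) = ⊥-elim (≢₁₃ (triangle-unique chordal S T))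
      threeShapes _ _ ≢₂₃ _ (star-u s) (star-u t) = ⊥-elim (≢₂₃ (stars-≡ u m₂ m₃ s t))
      threeShapes _ _ ≢₂₃ _ (star-v s) (star-v t) = ⊥-elim (≢₂₃ (stars-≡ v m₂ m₃ s t))
      threeShapes _ _ ≢₂₃ _ (triangle S) (triangle T) = ⊥-elim (≢₂₃ (triangle-unique chordal S T))
      threeShapes _ _ _ (triangle T) (star-u s) (star-v t) = inj₁ (covered T (stars-∪ m₂ m₃ s t))
      threeShapes _ _ _ (triangle T) (star-v s) (star-u t) =
        inj₁ (covered T (trans (stars-∪ m₃ m₂ t s) (∪-comm X₃ X₂)))
      threeShapes _ _ _ (star-u s) (triangle T) (star-v t) = inj₂ (inj₁ (covered T (stars-∪ m₁ m₃ s t)))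
      threeShapes _ _ _ (star-v s) (triangle T) (star-u t) =
        inj₂ (inj₁ (covered T (trans (stars-∪ m₃ m₁ t s) (∪-comm X₃ X₁))))
      threeShapes _ _ _ (star-u s) (star-v t) (triangle T) = inj₂ (inj₂ (covered T (stars-∪ m₁ m₂ s t)))
      threeShapes _ _ _ (star-v s) (star-u t) (triangle T) =
        inj₂ (inj₂ (covered T (trans (stars-∪ m₂ m₁ t s) (∪-comm X₂ X₁))))

mainTheorem13 : (L : Graph) → Chordal L → IsLineGraph L →
    (X₁ X₂ X₃ : Subset (n L)) →
    IsMaximalClique L X₁ → IsMaximalClique L X₂ → IsMaximalClique L X₃ →
    X₁ ≢ X₂ → X₁ ≢ X₃ → X₂ ≢ X₃ →
    ∃ (λ x → x ∈ (X₁ ∩ X₂) ∩ X₃) →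
    ((X₁ ⊆ X₂ ∪ X₃) × (∣ X₁ ∣ ≡ 3))
    ⊎ ((X₂ ⊆ X₁ ∪ X₃) × (∣ X₂ ∣ ≡ 3))
    ⊎ ((X₃ ⊆ X₁ ∪ X₂) × (∣ X₃ ∣ ≡ 3))
mainTheorem13 L chordal (H , f , (f-injective , _) , iso) X₁ X₂ X₃ m₁ m₂ m₃ ≢₁₂ ≢₁₃ ≢₂₃ (x , x∈X₁₂₃) =
  threeShapes chordal m₁ m₂ m₃ ≢₁₂ ≢₁₃ ≢₂₃
    (shape (proj₁ m₁) x∈X₁) (shape (proj₁ m₂) x∈X₂) (shape (proj₁ m₃) x∈X₃)
  where
  open LineGraph L H f f-injective iso
  open AtEdge x
  x∈X₁₂ : x ∈ X₁ ∩ X₂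
  x∈X₁₂ = proj₁ (x∈p∩q⁻ (X₁ ∩ X₂) X₃ x∈X₁₂₃)
  x∈X₃ : x ∈ X₃
  x∈X₃ = proj₂ (x∈p∩q⁻ (X₁ ∩ X₂) X₃ x∈X₁₂₃)
  x∈X₁ : x ∈ X₁
  x∈X₁ = proj₁ (x∈p∩q⁻ X₁ X₂ x∈X₁₂)
  x∈X₂ : x ∈ X₂
  x∈X₂ = proj₂ (x∈p∩q⁻ X₁ X₂ x∈X₁₂)
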